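{- Let $G$ be the complement of the Higman–Sims graph (so $|V(G)|=100$ and $\alpha(G)=2$). Then $G$ has a model of $K_{50}$ in which every branch set has exactly two vertices; in particular $G$ has a model of $K_{\lceil |V(G)|/2\rceil}$ with every branch set of size at most two.
   Context: Let $S(3,6,22)$ be the Steiner system of $77$ $6$-subsets (blocks) of $\{1,\dots,22\}$ such that every $3$-subset lies in exactly one block. The Higman–Sims graph has vertex set consisting of the $77$ blocks, the $22$ points $1,\dots,22$, and one further vertex $\infty$; two blocks are adjacent iff disjoint, a point is adjacent to a block iff it belongs to the block, $\infty$ is adjacent to all $22$ points, and there are no other edges. It is strongly regular with parameters $(100,22,0,6)$. A model of $K_t$ in $G$ is a collection of $t$ pairwise disjoint vertex sets (branch sets), each inducing a connected subgraph, with an edge of $G$ between every two of them. -}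

module Defs where

open import Data.Bool using (Bool; true; false; _∧_; _∨_; not; if_then_else_)
open import Data.Nat using (ℕ; zero; suc; _≡ᵇ_; _<ᵇ_; _∸_)
open import Data.List using (List; []; _∷_)
open import Data.Fin using (Fin; toℕ)
open import Data.Fin.Subset using (Subset; _∈_; _∩_; Empty; Nonempty)
open import Data.Product using (Σ; ∃; ∃-syntax; _×_; _,_)
open import Relation.Binary.PropositionalEquality using (_≡_; _≢_)
open import Relation.Nullary using (¬_)
open import Level using (0ℓ)
open import Relation.Binary.Core using (Rel)

-- The Steiner system S(3,6,22): its 77 blocks on the points 1..22.
-- (Derived octads of the extended binary Golay code: octads containing
-- two fixed coordinates, with those two removed.  Checked by computer to
-- be an S(3,6,22): every 3-subset of {1..22} lies in exactly one block.
-- S(3,6,22) is unique up to isomorphism.)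

blocks : List (List ℕ)
blocks =
  ( (1 ∷ 2 ∷ 3 ∷ 5 ∷ 14 ∷ 17 ∷ [])
  ∷ (1 ∷ 2 ∷ 4 ∷ 13 ∷ 16 ∷ 22 ∷ [])
  ∷ (1 ∷ 2 ∷ 6 ∷ 7 ∷ 19 ∷ 21 ∷ [])
  ∷ (1 ∷ 2 ∷ 8 ∷ 11 ∷ 12 ∷ 18 ∷ [])
  ∷ (1 ∷ 2 ∷ 9 ∷ 10 ∷ 15 ∷ 20 ∷ [])
  ∷ (1 ∷ 3 ∷ 4 ∷ 11 ∷ 19 ∷ 20 ∷ [])
  ∷ (1 ∷ 3 ∷ 6 ∷ 8 ∷ 10 ∷ 13 ∷ [])
  ∷ (1 ∷ 3 ∷ 7 ∷ 9 ∷ 16 ∷ 18 ∷ [])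
  ∷ (1 ∷ 3 ∷ 12 ∷ 15 ∷ 21 ∷ 22 ∷ [])
  ∷ (1 ∷ 4 ∷ 5 ∷ 7 ∷ 8 ∷ 15 ∷ [])
  ∷ (1 ∷ 4 ∷ 6 ∷ 9 ∷ 12 ∷ 17 ∷ [])
  ∷ (1 ∷ 4 ∷ 10 ∷ 14 ∷ 18 ∷ 21 ∷ [])
  ∷ (1 ∷ 5 ∷ 6 ∷ 18 ∷ 20 ∷ 22 ∷ [])
  ∷ (1 ∷ 5 ∷ 9 ∷ 11 ∷ 13 ∷ 21 ∷ [])
  ∷ (1 ∷ 5 ∷ 10 ∷ 12 ∷ 16 ∷ 19 ∷ [])
  ∷ (1 ∷ 6 ∷ 11 ∷ 14 ∷ 15 ∷ 16 ∷ [])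
  ∷ (1 ∷ 7 ∷ 10 ∷ 11 ∷ 17 ∷ 22 ∷ [])
  ∷ (1 ∷ 7 ∷ 12 ∷ 13 ∷ 14 ∷ 20 ∷ [])
  ∷ (1 ∷ 8 ∷ 9 ∷ 14 ∷ 19 ∷ 22 ∷ [])
  ∷ (1 ∷ 8 ∷ 16 ∷ 17 ∷ 20 ∷ 21 ∷ [])
  ∷ (1 ∷ 13 ∷ 15 ∷ 17 ∷ 18 ∷ 19 ∷ [])
  ∷ (2 ∷ 3 ∷ 4 ∷ 8 ∷ 9 ∷ 21 ∷ [])
  ∷ (2 ∷ 3 ∷ 6 ∷ 12 ∷ 16 ∷ 20 ∷ [])
  ∷ (2 ∷ 3 ∷ 7 ∷ 11 ∷ 13 ∷ 15 ∷ [])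
  ∷ (2 ∷ 3 ∷ 10 ∷ 18 ∷ 19 ∷ 22 ∷ [])
  ∷ (2 ∷ 4 ∷ 5 ∷ 6 ∷ 10 ∷ 11 ∷ [])
  ∷ (2 ∷ 4 ∷ 7 ∷ 17 ∷ 18 ∷ 20 ∷ [])
  ∷ (2 ∷ 4 ∷ 12 ∷ 14 ∷ 15 ∷ 19 ∷ [])
  ∷ (2 ∷ 5 ∷ 7 ∷ 9 ∷ 12 ∷ 22 ∷ [])
  ∷ (2 ∷ 5 ∷ 8 ∷ 13 ∷ 19 ∷ 20 ∷ [])
  ∷ (2 ∷ 5 ∷ 15 ∷ 16 ∷ 18 ∷ 21 ∷ [])
  ∷ (2 ∷ 6 ∷ 8 ∷ 15 ∷ 17 ∷ 22 ∷ [])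
  ∷ (2 ∷ 6 ∷ 9 ∷ 13 ∷ 14 ∷ 18 ∷ [])
  ∷ (2 ∷ 7 ∷ 8 ∷ 10 ∷ 14 ∷ 16 ∷ [])
  ∷ (2 ∷ 9 ∷ 11 ∷ 16 ∷ 17 ∷ 19 ∷ [])
  ∷ (2 ∷ 10 ∷ 12 ∷ 13 ∷ 17 ∷ 21 ∷ [])
  ∷ (2 ∷ 11 ∷ 14 ∷ 20 ∷ 21 ∷ 22 ∷ [])
  ∷ (3 ∷ 4 ∷ 5 ∷ 12 ∷ 13 ∷ 18 ∷ [])
  ∷ (3 ∷ 4 ∷ 6 ∷ 7 ∷ 14 ∷ 22 ∷ [])
  ∷ (3 ∷ 4 ∷ 10 ∷ 15 ∷ 16 ∷ 17 ∷ [])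
  ∷ (3 ∷ 5 ∷ 6 ∷ 9 ∷ 15 ∷ 19 ∷ [])
  ∷ (3 ∷ 5 ∷ 7 ∷ 10 ∷ 20 ∷ 21 ∷ [])
  ∷ (3 ∷ 5 ∷ 8 ∷ 11 ∷ 16 ∷ 22 ∷ [])
  ∷ (3 ∷ 6 ∷ 11 ∷ 17 ∷ 18 ∷ 21 ∷ [])
  ∷ (3 ∷ 7 ∷ 8 ∷ 12 ∷ 17 ∷ 19 ∷ [])
  ∷ (3 ∷ 8 ∷ 14 ∷ 15 ∷ 18 ∷ 20 ∷ [])
  ∷ (3 ∷ 9 ∷ 10 ∷ 11 ∷ 12 ∷ 14 ∷ [])
  ∷ (3 ∷ 9 ∷ 13 ∷ 17 ∷ 20 ∷ 22 ∷ [])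
  ∷ (3 ∷ 13 ∷ 14 ∷ 16 ∷ 19 ∷ 21 ∷ [])
  ∷ (4 ∷ 5 ∷ 9 ∷ 14 ∷ 16 ∷ 20 ∷ [])
  ∷ (4 ∷ 5 ∷ 17 ∷ 19 ∷ 21 ∷ 22 ∷ [])
  ∷ (4 ∷ 6 ∷ 8 ∷ 16 ∷ 18 ∷ 19 ∷ [])
  ∷ (4 ∷ 6 ∷ 13 ∷ 15 ∷ 20 ∷ 21 ∷ [])
  ∷ (4 ∷ 7 ∷ 9 ∷ 10 ∷ 13 ∷ 19 ∷ [])
  ∷ (4 ∷ 7 ∷ 11 ∷ 12 ∷ 16 ∷ 21 ∷ [])
  ∷ (4 ∷ 8 ∷ 10 ∷ 12 ∷ 20 ∷ 22 ∷ [])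
  ∷ (4 ∷ 8 ∷ 11 ∷ 13 ∷ 14 ∷ 17 ∷ [])
  ∷ (4 ∷ 9 ∷ 11 ∷ 15 ∷ 18 ∷ 22 ∷ [])
  ∷ (5 ∷ 6 ∷ 7 ∷ 13 ∷ 16 ∷ 17 ∷ [])
  ∷ (5 ∷ 6 ∷ 8 ∷ 12 ∷ 14 ∷ 21 ∷ [])
  ∷ (5 ∷ 7 ∷ 11 ∷ 14 ∷ 18 ∷ 19 ∷ [])
  ∷ (5 ∷ 8 ∷ 9 ∷ 10 ∷ 17 ∷ 18 ∷ [])
  ∷ (5 ∷ 10 ∷ 13 ∷ 14 ∷ 15 ∷ 22 ∷ [])
  ∷ (5 ∷ 11 ∷ 12 ∷ 15 ∷ 17 ∷ 20 ∷ [])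
  ∷ (6 ∷ 7 ∷ 8 ∷ 9 ∷ 11 ∷ 20 ∷ [])
  ∷ (6 ∷ 7 ∷ 10 ∷ 12 ∷ 15 ∷ 18 ∷ [])
  ∷ (6 ∷ 9 ∷ 10 ∷ 16 ∷ 21 ∷ 22 ∷ [])
  ∷ (6 ∷ 10 ∷ 14 ∷ 17 ∷ 19 ∷ 20 ∷ [])
  ∷ (6 ∷ 11 ∷ 12 ∷ 13 ∷ 19 ∷ 22 ∷ [])
  ∷ (7 ∷ 8 ∷ 13 ∷ 18 ∷ 21 ∷ 22 ∷ [])
  ∷ (7 ∷ 9 ∷ 14 ∷ 15 ∷ 17 ∷ 21 ∷ [])
  ∷ (7 ∷ 15 ∷ 16 ∷ 19 ∷ 20 ∷ 22 ∷ [])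
  ∷ (8 ∷ 9 ∷ 12 ∷ 13 ∷ 15 ∷ 16 ∷ [])
  ∷ (8 ∷ 10 ∷ 11 ∷ 15 ∷ 19 ∷ 21 ∷ [])
  ∷ (9 ∷ 12 ∷ 18 ∷ 19 ∷ 20 ∷ 21 ∷ [])
  ∷ (10 ∷ 11 ∷ 13 ∷ 16 ∷ 18 ∷ 20 ∷ [])
  ∷ (12 ∷ 14 ∷ 16 ∷ 17 ∷ 18 ∷ 22 ∷ [])
  ∷ [])

nth : List (List ℕ) → ℕ → List ℕ
nth []       _       = []
nth (x ∷ xs) zero    = x
nth (x ∷ xs) (suc k) = nth xs k

block : ℕ → List ℕ
block k = nth blocks k

memᵇ : ℕ → List ℕ → Bool
memᵇ x []       = false
memᵇ x (y ∷ ys) = (x ≡ᵇ y) ∨ memᵇ x ys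

disjointᵇ : List ℕ → List ℕ → Bool
disjointᵇ []       ys = true
disjointᵇ (x ∷ xs) ys = not (memᵇ x ys) ∧ disjointᵇ xs ys

-- The Higman–Sims graph on vertex set Fin 100.
-- Encoding of vertices (by toℕ):
--   k ∈ {0..76}  : the block  block k
--   k ∈ {77..98} : the point  k ∸ 76   (so points 1..22)
--   k = 99       : the vertex ∞

isBlockᵇ : ℕ → Bool
isBlockᵇ k = k <ᵇ 77

isPointᵇ : ℕ → Bool
isPointᵇ k = not (k <ᵇ 77) ∧ (k <ᵇ 99)

isInftyᵇ : ℕ → Bool
isInftyᵇ k = k ≡ᵇ 99

incidentᵇ : ℕ → ℕ → Bool
incidentᵇ p b = isPointᵇ p ∧ isBlockᵇ b ∧ memᵇ (p ∸ 76) (block b)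

hsAdjℕ : ℕ → ℕ → Bool
hsAdjℕ a b =
     (isBlockᵇ a ∧ isBlockᵇ b ∧ not (a ≡ᵇ b) ∧ disjointᵇ (block a) (block b))
  ∨ incidentᵇ a b
  ∨ incidentᵇ b a
  ∨ (isInftyᵇ a ∧ isPointᵇ b)
  ∨ (isPointᵇ a ∧ isInftyᵇ b)

HSAdj : Rel (Fin 100) 0ℓ
HSAdj u v = hsAdjℕ (toℕ u) (toℕ v) ≡ true

HSCompAdj : Rel (Fin 100) 0ℓ
HSCompAdj u v = u ≢ v × ¬ HSAdj u v

data PathIn {n : ℕ} (Adj : Rel (Fin n) 0ℓ) (S : Subset n) : Fin n → Fin n → Set where
  here : ∀ {u} → PathIn Adj S u u
  step : ∀ {u w v} → Adj u w → w ∈ S → PathIn Adj S w v → PathIn Adj S u v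

ConnectedIn : {n : ℕ} → Rel (Fin n) 0ℓ → Subset n → Set
ConnectedIn Adj S = Nonempty S × (∀ {u v} → u ∈ S → v ∈ S → PathIn Adj S u v)

IsKModel : {n : ℕ} → Rel (Fin n) 0ℓ → (t : ℕ) → (Fin t → Subset n) → Set
IsKModel Adj t B =
    (∀ i → ConnectedIn Adj (B i))
  × (∀ i j → i ≢ j → Empty (B i ∩ B j))
  × (∀ i j → i ≢ j → ∃[ u ] ∃[ v ] (u ∈ B i × v ∈ B j × Adj u v))

{-# OPTIONS --safe #-}
module Submission where

open import Defs
open import Data.Nat using (ℕ; _≤_; ⌈_/2⌉)
open import Data.Fin using (Fin)
open import Data.Fin.Subset using (Subset; ∣_∣)
open import Data.Product using (Σ; _×_)
open import Relation.Binary.PropositionalEquality using (_≡_)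

-- The branch sets are the edges of a perfect matching of G, found by computer
-- search, in which every two matching edges are joined by an edge of G: no two
-- of them have all four cross pairs adjacent in the Higman–Sims graph.  Both
-- properties are decidable and finite, so they are checked by evaluation.

open import Data.Bool using (true)
open import Data.Bool.Properties using () renaming (_≟_ to _≟ᵇ_)
open import Data.Empty using (⊥; ⊥-elim)
open import Data.Fin using (zero; suc; toℕ; #_)
open import Data.Fin.Properties using (_≟_; all?)
open import Data.Fin.Subset using (_∈_; _∩_; _∪_; ⁅_⁆; Empty)
open import Data.Fin.Subset.Properties
  using (x∈⁅x⁆; x∈⁅y⁆⇒x≡y; x∈p∪q⁺; x∈p∪q⁻; x∈p∩q⁻; ∣⁅x⁆∣≡1; ∪-identityˡ; ∪-identityʳ)
open import Data.Nat using (_+_)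
open import Data.Nat.Properties using (≤-reflexive)
open import Data.Product using (∃-syntax; _,_; proj₁; proj₂)
open import Data.Sum using (_⊎_; inj₁; inj₂)
open import Data.Vec using (Vec; []; _∷_; lookup)
open import Function using (_∘_)
open import Level using (0ℓ)
open import Relation.Binary.Core using (Rel)
open import Relation.Binary.Definitions using (Decidable)
open import Relation.Binary.PropositionalEquality using (_≢_; refl; cong; sym; trans)
open import Relation.Nullary using (Dec; ¬?; _×-dec_; _⊎-dec_; _→-dec_)
open import Relation.Nullary.Decidable using (toWitness)

∈⁅x⁆∪⁅y⁆⁻ : ∀ {n} {x y z : Fin n} → z ∈ ⁅ x ⁆ ∪ ⁅ y ⁆ → z ≡ x ⊎ z ≡ y
∈⁅x⁆∪⁅y⁆⁻ {x = x} {y} z∈ with x∈p∪q⁻ ⁅ x ⁆ ⁅ y ⁆ z∈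
... | inj₁ z∈⁅x⁆ = inj₁ (x∈⁅y⁆⇒x≡y x z∈⁅x⁆)
... | inj₂ z∈⁅y⁆ = inj₂ (x∈⁅y⁆⇒x≡y y z∈⁅y⁆)

x∈⁅x⁆∪⁅y⁆ : ∀ {n} (x y : Fin n) → x ∈ ⁅ x ⁆ ∪ ⁅ y ⁆
x∈⁅x⁆∪⁅y⁆ x y = x∈p∪q⁺ (inj₁ (x∈⁅x⁆ x))

y∈⁅x⁆∪⁅y⁆ : ∀ {n} (x y : Fin n) → y ∈ ⁅ x ⁆ ∪ ⁅ y ⁆
y∈⁅x⁆∪⁅y⁆ x y = x∈p∪q⁺ (inj₂ (x∈⁅x⁆ y))

∣⁅x⁆∪⁅y⁆∣≡2 : ∀ {n} {x y : Fin n} → x ≢ y → ∣ ⁅ x ⁆ ∪ ⁅ y ⁆ ∣ ≡ 2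
∣⁅x⁆∪⁅y⁆∣≡2 {x = zero}  {zero}  x≢y = ⊥-elim (x≢y refl)
∣⁅x⁆∪⁅y⁆∣≡2 {x = zero}  {suc y} _   = cong (1 +_) (trans (cong ∣_∣ (∪-identityˡ ⁅ y ⁆)) (∣⁅x⁆∣≡1 y))
∣⁅x⁆∪⁅y⁆∣≡2 {x = suc x} {zero}  _   = cong (1 +_) (trans (cong ∣_∣ (∪-identityʳ ⁅ x ⁆)) (∣⁅x⁆∣≡1 x))
∣⁅x⁆∪⁅y⁆∣≡2 {x = suc x} {suc y} x≢y = ∣⁅x⁆∪⁅y⁆∣≡2 (x≢y ∘ cong suc)

module PairModel {n t : ℕ} (Adj : Rel (Fin n) 0ℓ) (a b : Fin t → Fin n) where

  branch : Fin t → Subset n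
  branch i = ⁅ a i ⁆ ∪ ⁅ b i ⁆

  a∈branch : ∀ i → a i ∈ branch i
  a∈branch i = x∈⁅x⁆∪⁅y⁆ (a i) (b i)

  b∈branch : ∀ i → b i ∈ branch i
  b∈branch i = y∈⁅x⁆∪⁅y⁆ (a i) (b i)

  ProperPair : Fin t → Set
  ProperPair i = a i ≢ b i × Adj (a i) (b i) × Adj (b i) (a i)

  Apart : Fin t → Fin t → Set
  Apart i j = a i ≢ a j × a i ≢ b j × b i ≢ a j × b i ≢ b j

  Touching : Fin t → Fin t → Set
  Touching i j = Adj (a i) (a j) ⊎ Adj (a i) (b j) ⊎ Adj (b i) (a j) ⊎ Adj (b i) (b j)

  IsPairModel : Set
  IsPairModel = (∀ i → ProperPair i) × (∀ i j → i ≢ j → Apart i j × Touching i j)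

  isPairModel? : Decidable Adj → Dec IsPairModel
  isPairModel? adj? =
    all? (λ i → ¬? (a i ≟ b i) ×-dec adj? (a i) (b i) ×-dec adj? (b i) (a i))
    ×-dec all? (λ i → all? (λ j → ¬? (i ≟ j) →-dec apart? i j ×-dec touching? i j))
    where
    apart? : ∀ i j → Dec (Apart i j)
    apart? i j = ¬? (a i ≟ a j) ×-dec ¬? (a i ≟ b j) ×-dec ¬? (b i ≟ a j) ×-dec ¬? (b i ≟ b j)

    touching? : ∀ i j → Dec (Touching i j)
    touching? i j = adj? (a i) (a j) ⊎-dec adj? (a i) (b j) ⊎-dec adj? (b i) (a j) ⊎-dec adj? (b i) (b j)

  branch-connected : ∀ {i} → ProperPair i → ConnectedIn Adj (branch i)
  branch-connected {i} (_ , ab , ba) =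
    (a i , a∈branch i) , λ u∈ v∈ → path (∈⁅x⁆∪⁅y⁆⁻ u∈) (∈⁅x⁆∪⁅y⁆⁻ v∈)
    where
    path : ∀ {u v} → u ≡ a i ⊎ u ≡ b i → v ≡ a i ⊎ v ≡ b i → PathIn Adj (branch i) u v
    path (inj₁ refl) (inj₁ refl) = here
    path (inj₂ refl) (inj₂ refl) = here
    path (inj₁ refl) (inj₂ refl) = step ab (b∈branch i) here
    path (inj₂ refl) (inj₁ refl) = step ba (a∈branch i) here

  branches-disjoint : ∀ {i j} → Apart i j → Empty (branch i ∩ branch j)
  branches-disjoint {i} {j} (aa , ab , ba , bb) (x , x∈∩) =
    meet (∈⁅x⁆∪⁅y⁆⁻ (proj₁ x∈both)) (∈⁅x⁆∪⁅y⁆⁻ (proj₂ x∈both))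
    where
    x∈both : x ∈ branch i × x ∈ branch j
    x∈both = x∈p∩q⁻ (branch i) (branch j) x∈∩
    meet : x ≡ a i ⊎ x ≡ b i → x ≡ a j ⊎ x ≡ b j → ⊥
    meet (inj₁ p) (inj₁ q) = aa (trans (sym p) q)
    meet (inj₁ p) (inj₂ q) = ab (trans (sym p) q)
    meet (inj₂ p) (inj₁ q) = ba (trans (sym p) q)
    meet (inj₂ p) (inj₂ q) = bb (trans (sym p) q)

  branches-adjacent : ∀ {i j} → Touching i j →
                      ∃[ u ] ∃[ v ] (u ∈ branch i × v ∈ branch j × Adj u v)
  branches-adjacent {i} {j} (inj₁ e) = _ , _ , a∈branch i , a∈branch j , e
  branches-adjacent {i} {j} (inj₂ (inj₁ e)) = _ , _ , a∈branch i , b∈branch j , e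
  branches-adjacent {i} {j} (inj₂ (inj₂ (inj₁ e))) = _ , _ , b∈branch i , a∈branch j , e
  branches-adjacent {i} {j} (inj₂ (inj₂ (inj₂ e))) = _ , _ , b∈branch i , b∈branch j , e

  isKModel : IsPairModel → IsKModel Adj t branch
  isKModel (proper , separated) =
      (λ i → branch-connected (proper i))
    , (λ i j i≢j → branches-disjoint (proj₁ (separated i j i≢j)))
    , (λ i j i≢j → branches-adjacent (proj₂ (separated i j i≢j)))

  ∣branch∣≡2 : IsPairModel → ∀ i → ∣ branch i ∣ ≡ 2
  ∣branch∣≡2 (proper , _) i = ∣⁅x⁆∪⁅y⁆∣≡2 (proj₁ (proper i))

hsCompAdj? : Decidable HSCompAdj
hsCompAdj? u v = ¬? (u ≟ v) ×-dec ¬? (hsAdjℕ (toℕ u) (toℕ v) ≟ᵇ true)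

matching : Vec (Fin 100 × Fin 100) 50
matching =
  (# 0 , # 84) ∷ (# 1 , # 38) ∷ (# 2 , # 64) ∷ (# 3 , # 16) ∷ (# 4 , # 24) ∷
  (# 5 , # 29) ∷ (# 6 , # 11) ∷ (# 7 , # 12) ∷ (# 8 , # 52) ∷ (# 9 , # 88) ∷
  (# 10 , # 31) ∷ (# 13 , # 25) ∷ (# 14 , # 63) ∷ (# 15 , # 54) ∷ (# 17 , # 49) ∷
  (# 18 , # 55) ∷ (# 19 , # 75) ∷ (# 20 , # 97) ∷ (# 21 , # 96) ∷ (# 22 , # 77) ∷
  (# 23 , # 45) ∷ (# 26 , # 35) ∷ (# 27 , # 30) ∷ (# 28 , # 80) ∷ (# 32 , # 68) ∷
  (# 33 , # 36) ∷ (# 34 , # 99) ∷ (# 37 , # 42) ∷ (# 39 , # 65) ∷ (# 40 , # 44) ∷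
  (# 41 , # 61) ∷ (# 43 , # 57) ∷ (# 46 , # 94) ∷ (# 47 , # 86) ∷ (# 48 , # 66) ∷
  (# 50 , # 71) ∷ (# 51 , # 74) ∷ (# 53 , # 73) ∷ (# 56 , # 95) ∷ (# 58 , # 79) ∷
  (# 59 , # 69) ∷ (# 60 , # 85) ∷ (# 62 , # 93) ∷ (# 67 , # 76) ∷ (# 70 , # 92) ∷
  (# 72 , # 90) ∷ (# 78 , # 82) ∷ (# 81 , # 83) ∷ (# 87 , # 91) ∷ (# 89 , # 98) ∷ []

open PairModel HSCompAdj (proj₁ ∘ lookup matching) (proj₂ ∘ lookup matching)

matching-isPairModel : IsPairModel
matching-isPairModel = toWitness {a? = isPairModel? hsCompAdj?} _

theorem3p18 : (Σ (Fin 50 → Subset 100) λ B → IsKModel HSCompAdj 50 B × (∀ i → ∣ B i ∣ ≡ 2))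
                × (Σ (Fin ⌈ 100 /2⌉ → Subset 100) λ B → IsKModel HSCompAdj ⌈ 100 /2⌉ B × (∀ i → ∣ B i ∣ ≤ 2))
theorem3p18 =
    (branch , isKModel matching-isPairModel , ∣branch∣≡2 matching-isPairModel)
  , (branch , isKModel matching-isPairModel , ≤-reflexive ∘ ∣branch∣≡2 matching-isPairModel)
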